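{- Let $S = (s_1, \ldots, s_m)$ be a sequence of $m \ge 1$ binary strings, each of length $n$, and let $s^* \in \{0,1\}^n$ be a string minimizing $\sum_{i=1}^m \mathsf{mirk}(s^*, s_i)$ over all strings in $\{0,1\}^n$. If two distinct columns $j, j' \in \{1,\ldots,n\}$ have the same type, then $s^*[j] = s^*[j']$.
   Context: For binary strings $s, s' \in \{0,1\}^n$, the Mirkin distance is $\mathsf{mirk}(s,s') = d_H(s,s')\cdot(n - d_H(s,s'))$, where $d_H$ is the Hamming distance. Two columns $j, j'$ of $S$ have the same type if $s_i[j] = s_i[j']$ for every $i \in \{1,\ldots,m\}$. -}

module Defs where

open import Data.Nat using (ℕ; zero; suc; _+_; _*_; _∸_)
open import Data.Bool using (Bool; true; false; if_then_else_)
open import Data.Fin using (Fin)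
open import Relation.Nullary using (¬_)
open import Relation.Binary.PropositionalEquality using (_≡_)
open import Data.Bool.Properties using (_≟_)
open import Relation.Nullary.Decidable using (⌊_⌋)
import Data.Vec.Functional as VF

BinStr : ℕ → Set
BinStr n = Fin n → Bool

∑ : ∀ {k} → (Fin k → ℕ) → ℕ
∑ {k} f = VF.foldr _+_ 0 f

hamming : ∀ {n} → BinStr n → BinStr n → ℕ
hamming s t = ∑ (λ j → if ⌊ s j ≟ t j ⌋ then 0 else 1)

mirk : ∀ {n} → BinStr n → BinStr n → ℕ
mirk {n} s t = hamming s t * (n ∸ hamming s t)

mirkCost : ∀ {m n} → (Fin m → BinStr n) → BinStr n → ℕ
mirkCost S x = ∑ (λ i → mirk x (S i))

SameType : ∀ {m n} → (Fin m → BinStr n) → Fin n → Fin n → Set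
SameType S j j' = ∀ i → S i j ≡ S i j'

module Submission where

-- Suppose s* is optimal but s*[j] = a ≠ b = s*[j'] for two columns
-- j, j' of the same type.  Compare s* with the two candidates
--   t₁ = s* with position j  overwritten by b,
--   t₂ = s* with position j' overwritten by a.
-- For every row r, r[j] = r[j'] = c equals exactly one of a, b, so one candidate
-- moves one step towards r and the other one step away: the Hamming distances
-- d_H(t₁,r), d_H(t₂,r) are d_H(s*,r) ± 1 in some order.  The Mirkin profile
-- d ↦ d·(n ∸ d) has constant second difference -2, hence
--   mirk(t₁,r) + mirk(t₂,r) + 2 = 2·mirk(s*,r)      for every row r.

open import Defs
open import Data.Bool using (Bool; false; true; if_then_else_)
open import Data.Bool.Properties using (_≟_)
open import Data.Fin using (Fin; zero; suc; punchIn)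
open import Data.Fin.Properties using (punchInᵢ≢i)
open import Data.Nat using (ℕ; zero; suc; _+_; _*_; _∸_; _≤_; z≤n; s≤s)
open import Data.Nat.Properties
  using (+-comm; +-identityʳ; +-mono-≤; *-zeroʳ; *-distribˡ-+; m+n∸m≡n;
         m≤n⇒∃[o]m+o≡n; m+1+n≰m; +-0-commutativeMonoid; module ≤-Reasoning)
open import Algebra.Properties.CommutativeMonoid.Sum +-0-commutativeMonoid
  using (sum-remove; sum-cong-≗)
open import Data.Nat.Tactic.RingSolver using (solve-∀)
open import Data.Product using (_×_; _,_)
open import Data.Sum using (_⊎_; inj₁; inj₂; [_,_])
open import Data.Vec.Functional using (updateAt; tail)
open import Data.Vec.Functional.Properties using (updateAt-updates; updateAt-minimal)
open import Function using (const)
open import Relation.Nullary using (¬_; yes; no; contradiction)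
open import Relation.Nullary.Decidable using (⌊_⌋)
open import Relation.Binary.PropositionalEquality
  using (_≡_; _≢_; refl; sym; trans; cong; cong₂; subst; subst₂; module ≡-Reasoning)

∑-exchange : ∀ {k} (f g : Fin k → ℕ) (p : Fin k) → (∀ q → q ≢ p → f q ≡ g q)
           → g p + ∑ f ≡ f p + ∑ g
∑-exchange {suc k} f g p agree = begin
  g p + ∑ f                  ≡⟨ cong (g p +_) (sum-remove {i = p} f) ⟩
  g p + (f p + rest f)       ≡⟨ +-comm-middle (g p) (f p) (rest f) ⟩
  f p + (g p + rest f)       ≡⟨ cong (λ x → f p + (g p + x)) rest-agree ⟩
  f p + (g p + rest g)       ≡⟨ cong (f p +_) (sym (sum-remove {i = p} g)) ⟩
  f p + ∑ g                  ∎
  where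
  open ≡-Reasoning
  rest : (Fin (suc k) → ℕ) → ℕ
  rest h = ∑ (λ q → h (punchIn p q))
  rest-agree : rest f ≡ rest g
  rest-agree = sum-cong-≗ (λ q → agree (punchIn p q) (punchInᵢ≢i p q))
  +-comm-middle : ∀ x y z → x + (y + z) ≡ y + (x + z)
  +-comm-middle = solve-∀

∑-≤-card : ∀ {k} (f : Fin k → ℕ) → (∀ q → f q ≤ 1) → ∑ f ≤ k
∑-≤-card {zero}  f f≤1 = z≤n
∑-≤-card {suc k} f f≤1 = +-mono-≤ (f≤1 zero) (∑-≤-card (tail f) (λ q → f≤1 (suc q)))

∑-affine : ∀ {k} (a c : ℕ) (f g h : Fin k → ℕ) → (∀ i → f i + g i + c ≡ a * h i)
         → ∑ f + ∑ g + k * c ≡ a * ∑ h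
∑-affine {zero}  a c f g h eq = sym (*-zeroʳ a)
∑-affine {suc k} a c f g h eq = begin
  (f₀ + F) + (g₀ + G) + (c + k * c)  ≡⟨ regroup f₀ F g₀ G c (k * c) ⟩
  (f₀ + g₀ + c) + (F + G + k * c)    ≡⟨ cong₂ _+_ (eq zero) (∑-affine a c (tail f) (tail g) (tail h) (λ i → eq (suc i))) ⟩
  a * h zero + a * ∑ (tail h)        ≡⟨ sym (*-distribˡ-+ a (h zero) (∑ (tail h))) ⟩
  a * ∑ h                            ∎
  where
  open ≡-Reasoning
  f₀ g₀ F G : ℕ
  f₀ = f zero
  g₀ = g zero
  F  = ∑ (tail f)
  G  = ∑ (tail g)
  regroup : ∀ x X y Y z Z → (x + X) + (y + Y) + (z + Z) ≡ (x + y + z) + (X + Y + Z)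
  regroup = solve-∀

mismatch : Bool → Bool → ℕ
mismatch x y = if ⌊ x ≟ y ⌋ then 0 else 1

mismatch-≤1 : ∀ x y → mismatch x y ≤ 1
mismatch-≤1 false false = z≤n
mismatch-≤1 false true  = s≤s z≤n
mismatch-≤1 true  false = s≤s z≤n
mismatch-≤1 true  true  = z≤n

mismatch-distinct : ∀ {a b} c → a ≢ b
                  → (mismatch a c ≡ 0 × mismatch b c ≡ 1) ⊎ (mismatch a c ≡ 1 × mismatch b c ≡ 0)
mismatch-distinct {false} {false} c     a≢b = contradiction refl a≢b
mismatch-distinct {true}  {true}  c     a≢b = contradiction refl a≢b
mismatch-distinct {false} {true}  false a≢b = inj₁ (refl , refl)
mismatch-distinct {false} {true}  true  a≢b = inj₂ (refl , refl)
mismatch-distinct {true}  {false} false a≢b = inj₂ (refl , refl)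
mismatch-distinct {true}  {false} true  a≢b = inj₁ (refl , refl)

hamming-≤ : ∀ {n} (s t : BinStr n) → hamming s t ≤ n
hamming-≤ s t = ∑-≤-card _ (λ q → mismatch-≤1 (s q) (t q))

set : ∀ {n} → BinStr n → Fin n → Bool → BinStr n
set s p v = updateAt s p (const v)

hamming-set : ∀ {n} (s t : BinStr n) (p : Fin n) (v : Bool)
            → mismatch (s p) (t p) + hamming (set s p v) t ≡ mismatch v (t p) + hamming s t
hamming-set s t p v =
  subst (λ x → mismatch (s p) (t p) + hamming (set s p v) t ≡ mismatch x (t p) + hamming s t)
        (updateAt-updates p s)
        (∑-exchange (λ q → mismatch (set s p v q) (t q)) (λ q → mismatch (s q) (t q)) p
                    (λ q q≢p → cong (λ x → mismatch x (t q)) (updateAt-minimal q p s q≢p)))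

-- The Mirkin distance as a function of the Hamming distance d:
-- mirk s t is definitionally mirkin n (hamming s t).
mirkin : ℕ → ℕ → ℕ
mirkin n d = d * (n ∸ d)

∸-of-sum : ∀ {n} a b → n ≡ a + b → n ∸ a ≡ b
∸-of-sum a b refl = m+n∸m≡n a b

mirkin-concave : ∀ n d → suc (suc d) ≤ n
               → mirkin n d + mirkin n (suc (suc d)) + 2 ≡ 2 * mirkin n (suc d)
mirkin-concave n d le with o , refl ← m≤n⇒∃[o]m+o≡n le = begin
  d * (n ∸ d) + suc (suc d) * (n ∸ suc (suc d)) + 2
    ≡⟨ cong₂ (λ x y → d * x + suc (suc d) * y + 2)
             (∸-of-sum d (suc (suc o)) (split₀ d o)) (m+n∸m≡n (suc (suc d)) o) ⟩
  d * suc (suc o) + suc (suc d) * o + 2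
    ≡⟨ second-difference d o ⟩
  2 * (suc d * suc o)
    ≡⟨ cong (λ x → 2 * (suc d * x)) (sym (∸-of-sum (suc d) (suc o) (split₁ d o))) ⟩
  2 * (suc d * (n ∸ suc d))
    ∎
  where
  open ≡-Reasoning
  split₀ : ∀ d o → suc (suc d) + o ≡ d + suc (suc o)
  split₀ = solve-∀
  split₁ : ∀ d o → suc (suc d) + o ≡ suc d + suc o
  split₁ = solve-∀
  second-difference : ∀ d o → d * suc (suc o) + suc (suc d) * o + 2 ≡ 2 * (suc d * suc o)
  second-difference = solve-∀

mirkin-spread : ∀ n {D D₁ D₂} → D₁ ≡ suc D → suc D₂ ≡ D → D₁ ≤ n
              → mirkin n D₁ + mirkin n D₂ + 2 ≡ 2 * mirkin n D
mirkin-spread n {D₁ = D₁} {D₂} refl refl le =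
  trans (cong (_+ 2) (+-comm (mirkin n D₁) (mirkin n D₂))) (mirkin-concave n D₂ le)

row-balance : ∀ {n} (s r : BinStr n) (j j' : Fin n) → s j ≢ s j' → r j ≡ r j'
            → mirk (set s j (s j')) r + mirk (set s j' (s j)) r + 2 ≡ 2 * mirk s r
row-balance {n} s r j j' a≢b rj≡rj' = [ a-agrees , b-agrees ] (mismatch-distinct (r j) a≢b)
  where
  t₁ t₂ : BinStr n
  t₁ = set s j (s j')
  t₂ = set s j' (s j)
  D : ℕ
  D  = hamming s r
  h₁ : mismatch (s j) (r j) + hamming t₁ r ≡ mismatch (s j') (r j) + D
  h₁ = hamming-set s r j (s j')
  h₂ : mismatch (s j') (r j) + hamming t₂ r ≡ mismatch (s j) (r j) + D
  h₂ = subst (λ c → mismatch (s j') c + hamming t₂ r ≡ mismatch (s j) c + D)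
             (sym rj≡rj') (hamming-set s r j' (s j))
  -- The candidate whose new bit disagrees with r moves one step away from r,
  -- the other one step closer.
  balance : ∀ {x y H H'} → x ≡ 0 → y ≡ 1 → x + H ≡ y + D → y + H' ≡ x + D → H ≤ n
          → mirkin n H + mirkin n H' + 2 ≡ 2 * mirkin n D
  balance refl refl = mirkin-spread n
  a-agrees : mismatch (s j) (r j) ≡ 0 × mismatch (s j') (r j) ≡ 1
           → mirk t₁ r + mirk t₂ r + 2 ≡ 2 * mirk s r
  a-agrees (a0 , b1) = balance a0 b1 h₁ h₂ (hamming-≤ t₁ r)
  b-agrees : mismatch (s j) (r j) ≡ 1 × mismatch (s j') (r j) ≡ 0
           → mirk t₁ r + mirk t₂ r + 2 ≡ 2 * mirk s r
  b-agrees (a1 , b0) = trans (cong (_+ 2) (+-comm (mirk t₁ r) (mirk t₂ r)))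
                             (balance b0 a1 h₂ h₁ (hamming-≤ t₂ r))

cost-balance : ∀ {m n} (S : Fin m → BinStr n) (s : BinStr n) (j j' : Fin n)
             → s j ≢ s j' → SameType S j j'
             → mirkCost S (set s j (s j')) + mirkCost S (set s j' (s j)) + m * 2 ≡ 2 * mirkCost S s
cost-balance S s j j' a≢b sameType =
  ∑-affine 2 2 _ _ _ (λ i → row-balance s (S i) j j' a≢b (sameType i))

lemma1 : (m n : ℕ) → 1 ≤ m → (S : Fin m → BinStr n) → (s* : BinStr n)
         → (∀ (t : BinStr n) → mirkCost S s* ≤ mirkCost S t)
         → (j j' : Fin n) → ¬ (j ≡ j') → SameType S j j'
         → s* j ≡ s* j'
lemma1 (suc m) n (s≤s z≤n) S s* optimal j j' _ sameType with s* j ≟ s* j'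
... | yes a≡b = a≡b
... | no  a≢b = contradiction candidates-beat-optimum (m+1+n≰m (C₁ + C₂))
  where
  open ≤-Reasoning
  C C₁ C₂ : ℕ
  C  = mirkCost S s*
  C₁ = mirkCost S (set s* j (s* j'))
  C₂ = mirkCost S (set s* j' (s* j))
  candidates-beat-optimum : C₁ + C₂ + suc m * 2 ≤ C₁ + C₂
  candidates-beat-optimum = begin
    C₁ + C₂ + suc m * 2  ≡⟨ cost-balance S s* j j' a≢b sameType ⟩
    C + (C + 0)          ≤⟨ +-mono-≤ (optimal _) (+-mono-≤ (optimal _) z≤n) ⟩
    C₁ + (C₂ + 0)        ≡⟨ cong (C₁ +_) (+-identityʳ C₂) ⟩
    C₁ + C₂              ∎
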